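{- Let $n\ge 1$ and consider the $n$-vertex Fibonacci graph $FG$ (vertices $1,\dots,n$; edges $(v,v+1)$ labelled $a_v$ for $1\le v\le n-1$ and $(v,v+2)$ labelled $b_v$ for $1\le v\le n-2$). Let $T(n)$ and $P(n)$ be the total number of terms and the number of plus operators in the expression of $FG$ produced by the DFS method. Then $$T(n)=\frac{1}{10}\left[\left(5+3\sqrt5\right)\left(\frac{1+\sqrt5}{2}\right)^n+\left(5-3\sqrt5\right)\left(\frac{1-\sqrt5}{2}\right)^n\right]-2,$$ $$P(n)=\frac{1}{\sqrt5}\left[\left(\frac{1+\sqrt5}{2}\right)^n-\left(\frac{1-\sqrt5}{2}\right)^n\right]-1.$$
   Context: The DFS method defines subexpressions $E_i$ for $i=n,n-1,\dots,1$: $E_n=1$; $E_{n-1}=a_{n-1}$; and for $i<n-1$, $E_i=a_iE_{i+1}+b_iE_{i+2}$ (sums are parenthesized when multiplied). The resulting expression is $E_1$. A factor equal to the constant $1$ is omitted from products, and the constant $1$ is not counted as a term. The total number of terms of an expression is the number of occurrences of edge labels in it, counted with multiplicity; the number of plus operators is the number of occurrences of $+$. -}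

module Defs where

open import Data.Nat as ℕ using (ℕ; zero; suc; _∸_)
open import Data.Integer as ℤ using (ℤ; +_; -[1+_])

data Expr : Set where
  one  : Expr
  a    : ℕ → Expr
  b    : ℕ → Expr
  _⊕_  : Expr → Expr → Expr
  _⊗_  : Expr → Expr → Expr

mul : Expr → Expr → Expr
mul one y = y
mul x one = x
mul x y   = x ⊗ y

terms : Expr → ℕ
terms one     = 0
terms (a _)   = 1
terms (b _)   = 1
terms (x ⊕ y) = terms x ℕ.+ terms y
terms (x ⊗ y) = terms x ℕ.+ terms y

pluses : Expr → ℕ
pluses one     = 0
pluses (a _)   = 0
pluses (b _)   = 0
pluses (x ⊕ y) = suc (pluses x ℕ.+ pluses y)
pluses (x ⊗ y) = pluses x ℕ.+ pluses y

-- DFS subexpressions of the n-vertex Fibonacci graph: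
-- Ek n k = E_{n-k}, i.e.  E_n = 1, E_{n-1} = a_{n-1},
-- E_i = a_i E_{i+1} + b_i E_{i+2}  for i = n-(k+2) < n-1.
Ek : ℕ → ℕ → Expr
Ek n zero          = one
Ek n (suc zero)    = a (n ∸ 1)
Ek n (suc (suc k)) = mul (a (n ∸ (k ℕ.+ 2))) (Ek n (suc k))
                   ⊕ mul (b (n ∸ (k ℕ.+ 2))) (Ek n k)

-- the expression E_1 of FG produced by the DFS method (for n ≥ 1)
dfsExpr : ℕ → Expr
dfsExpr n = Ek n (n ∸ 1)

T : ℕ → ℕ
T n = terms (dfsExpr n)

P : ℕ → ℕ
P n = pluses (dfsExpr n)

-- The ring ℤ[√5]: x + y√5 represented as ⟨ x , y ⟩

record ℤ√5 : Set where
  constructor ⟨_,_⟩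
  field
    re : ℤ
    ir : ℤ

infixl 6 _+ᵣ_ _-ᵣ_
infixl 7 _*ᵣ_

_+ᵣ_ : ℤ√5 → ℤ√5 → ℤ√5
⟨ x , y ⟩ +ᵣ ⟨ u , v ⟩ = ⟨ x ℤ.+ u , y ℤ.+ v ⟩

_-ᵣ_ : ℤ√5 → ℤ√5 → ℤ√5
⟨ x , y ⟩ -ᵣ ⟨ u , v ⟩ = ⟨ x ℤ.- u , y ℤ.- v ⟩

_*ᵣ_ : ℤ√5 → ℤ√5 → ℤ√5
⟨ x , y ⟩ *ᵣ ⟨ u , v ⟩ = ⟨ x ℤ.* u ℤ.+ + 5 ℤ.* y ℤ.* v , x ℤ.* v ℤ.+ y ℤ.* u ⟩

_^ᵣ_ : ℤ√5 → ℕ → ℤ√5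
z ^ᵣ zero  = ⟨ + 1 , + 0 ⟩
z ^ᵣ suc n = z *ᵣ (z ^ᵣ n)

fromℕ : ℕ → ℤ√5
fromℕ m = ⟨ + m , + 0 ⟩

√5 : ℤ√5
√5 = ⟨ + 0 , + 1 ⟩

-- Since E_i = a_i E_(i+1) + b_i E_(i+2), the term count t and plus count p of E_(n-k) satisfy
-- t(k+2) + 2 = (t(k+1) + 2) + (t(k) + 2) and likewise for p + 1; with the initial values this
-- gives T(n) + 2 = F(n+2) and P(n) + 1 = F(n).  Binet's formula is then checked in ℤ[√5] with
-- denominators cleared: 1 - √5 is the Galois conjugate of 1 + √5 = 2φ, so the right-hand sides
-- are a trace and a difference of conjugates, and (1 + √5)ⁿ⁺¹ = 2ⁿ ((F(n+1) + 2F(n)) + F(n+1) √5)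
-- expresses both through Fibonacci numbers.
module Submission where

open import Defs
open import Data.Nat using (ℕ; zero; suc; _+_; _*_; _^_; _≤_)
open import Data.Nat.Properties using (+-identityʳ; +-comm)
import Data.Nat.Tactic.RingSolver as ℕ-Solver
open import Data.Integer as ℤ using (+_; -_)
open import Data.Integer.Properties using (pos-*; +-inverseʳ)
import Data.Integer.Tactic.RingSolver as ℤ-Solver
open import Data.Product using (_×_; _,_)
open import Relation.Binary.PropositionalEquality
  using (_≡_; refl; sym; trans; cong; cong₂; module ≡-Reasoning)

fib : ℕ → ℕ
fib zero          = 0
fib (suc zero)    = 1
fib (suc (suc n)) = fib (suc n) + fib n

fib-recurrence⇒shifted-fib : (u : ℕ → ℕ) (j : ℕ) →
  (∀ k → u (suc (suc k)) ≡ u (suc k) + u k) →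
  u 0 ≡ fib j → u 1 ≡ fib (suc j) → ∀ k → u k ≡ fib (k + j)
fib-recurrence⇒shifted-fib u j rec u₀ u₁ zero          = u₀
fib-recurrence⇒shifted-fib u j rec u₀ u₁ (suc zero)    = u₁
fib-recurrence⇒shifted-fib u j rec u₀ u₁ (suc (suc k)) = trans (rec k)
  (cong₂ _+_ (fib-recurrence⇒shifted-fib u j rec u₀ u₁ (suc k))
             (fib-recurrence⇒shifted-fib u j rec u₀ u₁ k))

mul-additive : (f : Expr → ℕ) → f one ≡ 0 → (∀ x y → f (x ⊗ y) ≡ f x + f y) →
               ∀ x y → f (mul x y) ≡ f x + f y
mul-additive f f-one f-⊗ = go
  where
  unitˡ : ∀ y → f y ≡ f one + f y
  unitˡ y = cong (_+ f y) (sym f-one)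

  unitʳ : ∀ x → f x ≡ f x + f one
  unitʳ x = trans (sym (+-identityʳ (f x))) (cong (λ c → f x + c) (sym f-one))

  -- mul computes only on constructor-headed arguments, hence the full case split.
  go : ∀ x y → f (mul x y) ≡ f x + f y
  go one     y       = unitˡ y
  go (a i)   one     = unitʳ (a i)
  go (b i)   one     = unitʳ (b i)
  go (x ⊕ y) one     = unitʳ (x ⊕ y)
  go (x ⊗ y) one     = unitʳ (x ⊗ y)
  go (a i)   (a j)   = f-⊗ _ _
  go (a i)   (b j)   = f-⊗ _ _
  go (a i)   (z ⊕ w) = f-⊗ _ _
  go (a i)   (z ⊗ w) = f-⊗ _ _
  go (b i)   (a j)   = f-⊗ _ _
  go (b i)   (b j)   = f-⊗ _ _
  go (b i)   (z ⊕ w) = f-⊗ _ _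
  go (b i)   (z ⊗ w) = f-⊗ _ _
  go (x ⊕ y) (a j)   = f-⊗ _ _
  go (x ⊕ y) (b j)   = f-⊗ _ _
  go (x ⊕ y) (z ⊕ w) = f-⊗ _ _
  go (x ⊕ y) (z ⊗ w) = f-⊗ _ _
  go (x ⊗ y) (a j)   = f-⊗ _ _
  go (x ⊗ y) (b j)   = f-⊗ _ _
  go (x ⊗ y) (z ⊕ w) = f-⊗ _ _
  go (x ⊗ y) (z ⊗ w) = f-⊗ _ _

terms-mul : ∀ x y → terms (mul x y) ≡ terms x + terms y
terms-mul = mul-additive terms refl (λ _ _ → refl)

pluses-mul : ∀ x y → pluses (mul x y) ≡ pluses x + pluses y
pluses-mul = mul-additive pluses refl (λ _ _ → refl)

terms-Ek-rec : ∀ n k →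
  terms (Ek n (suc (suc k))) ≡ suc (terms (Ek n (suc k))) + suc (terms (Ek n k))
terms-Ek-rec n k = cong₂ _+_ (terms-mul (a _) (Ek n (suc k))) (terms-mul (b _) (Ek n k))

pluses-Ek-rec : ∀ n k →
  pluses (Ek n (suc (suc k))) ≡ suc (pluses (Ek n (suc k)) + pluses (Ek n k))
pluses-Ek-rec n k = cong suc (cong₂ _+_ (pluses-mul (a _) (Ek n (suc k))) (pluses-mul (b _) (Ek n k)))

terms-Ek : ∀ n k → terms (Ek n k) + 2 ≡ fib (k + 3)
terms-Ek n = fib-recurrence⇒shifted-fib (λ k → terms (Ek n k) + 2) 3 rec refl refl
  where
  shift : ∀ t₁ t₀ → suc t₁ + suc t₀ + 2 ≡ (t₁ + 2) + (t₀ + 2)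
  shift = ℕ-Solver.solve-∀

  rec : ∀ k → terms (Ek n (suc (suc k))) + 2 ≡ (terms (Ek n (suc k)) + 2) + (terms (Ek n k) + 2)
  rec k = trans (cong (_+ 2) (terms-Ek-rec n k)) (shift (terms (Ek n (suc k))) (terms (Ek n k)))

pluses-Ek : ∀ n k → pluses (Ek n k) + 1 ≡ fib (k + 1)
pluses-Ek n = fib-recurrence⇒shifted-fib (λ k → pluses (Ek n k) + 1) 1 rec refl refl
  where
  shift : ∀ p₁ p₀ → suc (p₁ + p₀) + 1 ≡ (p₁ + 1) + (p₀ + 1)
  shift = ℕ-Solver.solve-∀

  rec : ∀ k → pluses (Ek n (suc (suc k))) + 1 ≡ (pluses (Ek n (suc k)) + 1) + (pluses (Ek n k) + 1)
  rec k = trans (cong (_+ 1) (pluses-Ek-rec n k)) (shift (pluses (Ek n (suc k))) (pluses (Ek n k)))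

T+2≡fib : ∀ m → T (suc m) + 2 ≡ fib (2 + suc m)
T+2≡fib m = trans (terms-Ek (suc m) m) (cong fib (+-comm m 3))

P+1≡fib : ∀ m → P (suc m) + 1 ≡ fib (suc m)
P+1≡fib m = trans (pluses-Ek (suc m) m) (cong fib (+-comm m 1))

conj : ℤ√5 → ℤ√5
conj ⟨ x , y ⟩ = ⟨ x , - y ⟩

conj-*ᵣ : ∀ z w → conj (z *ᵣ w) ≡ conj z *ᵣ conj w
conj-*ᵣ ⟨ x , y ⟩ ⟨ u , v ⟩ = cong₂ ⟨_,_⟩ (re-eq x y u v) (ir-eq x y u v)
  where
  re-eq : ∀ x y u v → x ℤ.* u ℤ.+ + 5 ℤ.* y ℤ.* v ≡ x ℤ.* u ℤ.+ + 5 ℤ.* (- y) ℤ.* (- v)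
  re-eq = ℤ-Solver.solve-∀

  ir-eq : ∀ x y u v → - (x ℤ.* v ℤ.+ y ℤ.* u) ≡ x ℤ.* (- v) ℤ.+ (- y) ℤ.* u
  ir-eq = ℤ-Solver.solve-∀

conj-^ᵣ : ∀ z n → conj (z ^ᵣ n) ≡ conj z ^ᵣ n
conj-^ᵣ z zero    = refl
conj-^ᵣ z (suc n) = trans (conj-*ᵣ z (z ^ᵣ n)) (cong (conj z *ᵣ_) (conj-^ᵣ z n))

pos-*ᵣ : ∀ p q x y →
  ⟨ + p , + q ⟩ *ᵣ ⟨ + x , + y ⟩ ≡ ⟨ + (p * x + 5 * q * y) , + (p * y + q * x) ⟩
pos-*ᵣ p q x y = sym (cong₂ ⟨_,_⟩
  (cong₂ ℤ._+_ (pos-* p x) (trans (pos-* (5 * q) y) (cong (ℤ._* + y) (pos-* 5 q))))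
  (cong₂ ℤ._+_ (pos-* p y) (pos-* q x)))

pos-+ᵣ-conj : ∀ r s → ⟨ + r , + s ⟩ +ᵣ conj ⟨ + r , + s ⟩ ≡ fromℕ (r + r)
pos-+ᵣ-conj r s = cong ⟨ + (r + r) ,_⟩ (+-inverseʳ (+ s))

pos--ᵣ-conj : ∀ r s → ⟨ + r , + s ⟩ -ᵣ conj ⟨ + r , + s ⟩ ≡ √5 *ᵣ fromℕ (s + s)
pos--ᵣ-conj r s = cong₂ ⟨_,_⟩ (+-inverseʳ (+ r)) (ir-eq (+ s))
  where
  ir-eq : ∀ y → y ℤ.- (- y) ≡ + 0 ℤ.* + 0 ℤ.+ + 1 ℤ.* (y ℤ.+ y)
  ir-eq = ℤ-Solver.solve-∀

1+√5-^ᵣ-suc : ∀ n → ⟨ + 1 , + 1 ⟩ ^ᵣ suc n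
  ≡ ⟨ + (2 ^ n * (fib (suc n) + 2 * fib n)) , + (2 ^ n * fib (suc n)) ⟩
1+√5-^ᵣ-suc zero    = pos-*ᵣ 1 1 1 0
1+√5-^ᵣ-suc (suc n) = begin
  ⟨ + 1 , + 1 ⟩ *ᵣ ⟨ + 1 , + 1 ⟩ ^ᵣ suc n
    ≡⟨ cong (⟨ + 1 , + 1 ⟩ *ᵣ_) (1+√5-^ᵣ-suc n) ⟩
  ⟨ + 1 , + 1 ⟩ *ᵣ ⟨ + (e * (f₁ + 2 * f₀)) , + (e * f₁) ⟩
    ≡⟨ pos-*ᵣ 1 1 (e * (f₁ + 2 * f₀)) (e * f₁) ⟩
  ⟨ + (1 * (e * (f₁ + 2 * f₀)) + 5 * 1 * (e * f₁)) , + (1 * (e * f₁) + 1 * (e * (f₁ + 2 * f₀))) ⟩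
    ≡⟨ cong₂ (λ x y → ⟨ + x , + y ⟩) (re-eq e f₁ f₀) (ir-eq e f₁ f₀) ⟩
  ⟨ + (2 * e * ((f₁ + f₀) + 2 * f₁)) , + (2 * e * (f₁ + f₀)) ⟩ ∎
  where
  open ≡-Reasoning
  e = 2 ^ n
  f₁ = fib (suc n)
  f₀ = fib n

  re-eq : ∀ e f₁ f₀ → 1 * (e * (f₁ + 2 * f₀)) + 5 * 1 * (e * f₁) ≡ 2 * e * ((f₁ + f₀) + 2 * f₁)
  re-eq = ℕ-Solver.solve-∀

  ir-eq : ∀ e f₁ f₀ → 1 * (e * f₁) + 1 * (e * (f₁ + 2 * f₀)) ≡ 2 * e * (f₁ + f₀)
  ir-eq = ℕ-Solver.solve-∀

binet : ∀ n → √5 *ᵣ fromℕ (2 ^ suc n * fib (suc n))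
  ≡ ⟨ + 1 , + 1 ⟩ ^ᵣ suc n -ᵣ ⟨ + 1 , - (+ 1) ⟩ ^ᵣ suc n
binet n = begin
  √5 *ᵣ fromℕ (2 ^ suc n * fib (suc n))  ≡⟨ cong (λ c → √5 *ᵣ fromℕ c) (double (2 ^ n) (fib (suc n))) ⟩
  √5 *ᵣ fromℕ (Y + Y)                    ≡⟨ sym (pos--ᵣ-conj X Y) ⟩
  ⟨ + X , + Y ⟩ -ᵣ conj ⟨ + X , + Y ⟩    ≡⟨ cong (λ w → w -ᵣ conj w) (sym (1+√5-^ᵣ-suc n)) ⟩
  ω ^ᵣ suc n -ᵣ conj (ω ^ᵣ suc n)        ≡⟨ cong (ω ^ᵣ suc n -ᵣ_) (conj-^ᵣ ω (suc n)) ⟩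
  ω ^ᵣ suc n -ᵣ conj ω ^ᵣ suc n          ∎
  where
  open ≡-Reasoning
  ω = ⟨ + 1 , + 1 ⟩
  X = 2 ^ n * (fib (suc n) + 2 * fib n)
  Y = 2 ^ n * fib (suc n)

  double : ∀ e f → 2 * e * f ≡ e * f + e * f
  double = ℕ-Solver.solve-∀

binet-2+ : ∀ n → fromℕ (10 * 2 ^ suc n * fib (2 + suc n))
  ≡ ⟨ + 5 , + 3 ⟩ *ᵣ ⟨ + 1 , + 1 ⟩ ^ᵣ suc n +ᵣ ⟨ + 5 , - (+ 3) ⟩ *ᵣ ⟨ + 1 , - (+ 1) ⟩ ^ᵣ suc n
binet-2+ n = begin
  fromℕ (10 * 2 ^ suc n * fib (2 + suc n))  ≡⟨ cong fromℕ (twice-re (2 ^ n) (fib (suc n)) (fib n)) ⟩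
  fromℕ (R + R)                             ≡⟨ sym (pos-+ᵣ-conj R S) ⟩
  ⟨ + R , + S ⟩ +ᵣ conj ⟨ + R , + S ⟩       ≡⟨ cong (λ w → w +ᵣ conj w) (sym α*ω^n) ⟩
  α *ᵣ ω ^ᵣ suc n +ᵣ conj (α *ᵣ ω ^ᵣ suc n) ≡⟨ cong (α *ᵣ ω ^ᵣ suc n +ᵣ_) (conj-*ᵣ α (ω ^ᵣ suc n)) ⟩
  α *ᵣ ω ^ᵣ suc n +ᵣ conj α *ᵣ conj (ω ^ᵣ suc n)
                                            ≡⟨ cong (λ w → α *ᵣ ω ^ᵣ suc n +ᵣ conj α *ᵣ w) (conj-^ᵣ ω (suc n)) ⟩
  α *ᵣ ω ^ᵣ suc n +ᵣ conj α *ᵣ conj ω ^ᵣ suc n ∎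
  where
  open ≡-Reasoning
  ω = ⟨ + 1 , + 1 ⟩
  α = ⟨ + 5 , + 3 ⟩
  X = 2 ^ n * (fib (suc n) + 2 * fib n)
  Y = 2 ^ n * fib (suc n)
  R = 5 * X + 5 * 3 * Y
  S = 5 * Y + 3 * X

  α*ω^n : α *ᵣ ω ^ᵣ suc n ≡ ⟨ + R , + S ⟩
  α*ω^n = trans (cong (α *ᵣ_) (1+√5-^ᵣ-suc n)) (pos-*ᵣ 5 3 X Y)

  twice-re : ∀ e f₁ f₀ → 10 * (2 * e) * ((f₁ + f₀) + f₁)
    ≡ (5 * (e * (f₁ + 2 * f₀)) + 5 * 3 * (e * f₁)) + (5 * (e * (f₁ + 2 * f₀)) + 5 * 3 * (e * f₁))
  twice-re = ℕ-Solver.solve-∀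

corollary2 : (n : ℕ) → 1 ≤ n →
    (fromℕ (10 * 2 ^ n * (T n + 2))
      ≡ (⟨ + 5 , + 3 ⟩) *ᵣ ((⟨ + 1 , + 1 ⟩) ^ᵣ n)
        +ᵣ (⟨ + 5 , - (+ 3) ⟩) *ᵣ ((⟨ + 1 , - (+ 1) ⟩) ^ᵣ n))
    × (√5 *ᵣ fromℕ (2 ^ n * (P n + 1))
      ≡ ((⟨ + 1 , + 1 ⟩) ^ᵣ n) -ᵣ ((⟨ + 1 , - (+ 1) ⟩) ^ᵣ n))
corollary2 (suc m) _ =
  trans (cong (λ t → fromℕ (10 * 2 ^ suc m * t)) (T+2≡fib m)) (binet-2+ m) ,
  trans (cong (λ p → √5 *ᵣ fromℕ (2 ^ suc m * p)) (P+1≡fib m)) (binet m)
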